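{- Let $p$ be a prime, $\gamma\in(0,1)$, and let $I$ and $J$ be two intervals containing $h$ and $H$ consecutive integers respectively, with $h\le H<\gamma p/15$. Assume that for some integer $s$ the congruence $y\equiv sx\pmod p$ has at least $\gamma h+1$ solutions with $x\in I$, $y\in J$. Then there exist integers $a$ and $b$ with $$|a|\le\frac{H}{\gamma h},\qquad 0<b\le\frac1\gamma,$$ such that $s\equiv a/b\pmod p$.
   Formalization: The parameter γ ranges over the rationals in (0,1). -}

module Defs where

open import Data.Nat as ℕ using (ℕ)
open import Data.Integer as ℤ using (ℤ; +_)
open import Data.Integer.Divisibility.Signed using (_∣_; _∣?_)
open import Data.Rational as ℚ using (ℚ; _/_)
open import Data.List using (List; length; filter; upTo; cartesianProduct)
open import Data.Product using (_×_; _,_)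

ℤ→ℚ : ℤ → ℚ
ℤ→ℚ z = z / 1

ℕ→ℚ : ℕ → ℚ
ℕ→ℚ n = (+ n) / 1

_≡_[mod_] : ℤ → ℤ → ℕ → Set
a ≡ b [mod p ] = (+ p) ∣ (a ℤ.- b)

interval : ℤ → ℕ → List ℤ
interval x₀ h = Data.List.map (λ i → x₀ ℤ.+ (+ ℕ.suc i)) (upTo h)

numSolutions : ℕ → ℤ → List ℤ → List ℤ → ℕ
numSolutions p s I J =
  length (filter (λ { (x , y) → (+ p) ∣? (y ℤ.- s ℤ.* x) }) (cartesianProduct I J))

{-# OPTIONS --safe #-}

-- Write γ = g / D and the solutions as (x₀ + 1 + u , y₀ + 1 + v). Sorting the at least
-- γ h + 1 solutions into the fewer boxes ⌊u γ⌋ gives two with 0 < u − u′ < 1/γ; as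
-- v − v′ ≡ s (u − u′) and p is prime, the fraction (v − v′) / (u − u′) in lowest terms is
-- some a / b with a ≡ s b, b < 1/γ and |a| < H. If |a| γ h > H, then |a| u ± b v lies in a
-- single residue class mod p for all solutions, so by coprimality a solution is determined
-- by ⌊(|a| u ± b v) / p⌋ and ⌊v / |a|⌋; there are at most (1 + (|a| h + b H) / p) (1 + H / |a|)
-- such pairs, and 15 H < γ p makes this less than γ h + 1.
module Submission where

module Counting where
  open import Data.Nat
  open import Data.Nat.Properties
  open import Data.Nat.DivMod
  open import Data.Nat.Divisibility
  open import Data.Nat.Coprimality using (Coprime; coprime-divisor)
  open import Data.Fin using (Fin; fromℕ<; combine)
  open import Data.Fin.Properties using (fromℕ<-injective; combine-injective; injective⇒≤)
  open import Data.Product using (_×_; _,_)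
  open import Data.Sum using (inj₁; inj₂)
  open import Data.Empty using (⊥-elim)
  open import Relation.Binary.PropositionalEquality

  ∣∧<⇒≡0 : ∀ {d n} → d ∣ n → n < d → n ≡ 0
  ∣∧<⇒≡0 {n = zero}  _   _   = refl
  ∣∧<⇒≡0 {n = suc n} d∣n n<d = ⊥-elim (<⇒≱ n<d (∣⇒≤ d∣n))

  /-≡⇒∸< : ∀ {m n} d .{{_ : NonZero d}} → n ≤ m → m / d ≡ n / d → m ∸ n < d
  /-≡⇒∸< {m} {n} d n≤m m/d≡n/d = +-cancelʳ-< n (m ∸ n) d (begin-strict
    m ∸ n + n          ≡⟨ m∸n+n≡m n≤m ⟩
    m                  ≡⟨ m≡m%n+[m/n]*n m d ⟩
    m % d + m / d * d  <⟨ +-monoˡ-< (m / d * d) (m%n<n m d) ⟩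
    d + m / d * d      ≡⟨ cong (λ q → d + q * d) m/d≡n/d ⟩
    d + n / d * d      ≤⟨ +-monoʳ-≤ d (m/n*n≤m n d) ⟩
    d + n              ∎)
    where open ≤-Reasoning

  ∣∸∧/-≡⇒≡ : ∀ {m n} d .{{_ : NonZero d}} → n ≤ m → d ∣ m ∸ n → m / d ≡ n / d → m ≡ n
  ∣∸∧/-≡⇒≡ d n≤m d∣m∸n m/d≡n/d =
    ≤-antisym (m∸n≡0⇒m≤n (∣∧<⇒≡0 d∣m∸n (/-≡⇒∸< d n≤m m/d≡n/d))) n≤m

  coprime-line-unique : ∀ {A b u₁ u₂ w₁ w₂} .{{_ : NonZero A}} → Coprime A b →
    w₂ ≤ w₁ → w₁ ∸ w₂ < A → A * u₁ + b * w₁ ≡ A * u₂ + b * w₂ → u₁ ≡ u₂ × w₁ ≡ w₂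
  coprime-line-unique {A} {b} {u₁} {u₂} {w₁} {w₂} A⊥b w₂≤w₁ δ<A eq = u₁≡u₂ , w₁≡w₂
    where
    δ = w₁ ∸ w₂
    shifted : A * u₁ + b * δ ≡ A * u₂
    shifted = +-cancelʳ-≡ (b * w₂) _ _ (begin
      A * u₁ + b * δ + b * w₂    ≡⟨ +-assoc (A * u₁) (b * δ) (b * w₂) ⟩
      A * u₁ + (b * δ + b * w₂)  ≡⟨ cong (A * u₁ +_) (sym (*-distribˡ-+ b δ w₂)) ⟩
      A * u₁ + b * (δ + w₂)      ≡⟨ cong (λ w → A * u₁ + b * w) (m∸n+n≡m w₂≤w₁) ⟩
      A * u₁ + b * w₁            ≡⟨ eq ⟩
      A * u₂ + b * w₂            ∎)
      where open ≡-Reasoning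
    A∣bδ : A ∣ b * δ
    A∣bδ = ∣m+n∣m⇒∣n (subst (A ∣_) (sym shifted) (m∣m*n u₂)) (m∣m*n u₁)
    w₁≡w₂ : w₁ ≡ w₂
    w₁≡w₂ = ≤-antisym (m∸n≡0⇒m≤n (∣∧<⇒≡0 (coprime-divisor A⊥b A∣bδ) δ<A)) w₂≤w₁
    u₁≡u₂ : u₁ ≡ u₂
    u₁≡u₂ = *-cancelˡ-≡ u₁ u₂ A (+-cancelʳ-≡ (b * w₂) (A * u₁) (A * u₂)
      (subst (λ w → A * u₁ + b * w ≡ A * u₂ + b * w₂) w₁≡w₂ eq))

  -- ⌊F i / p⌋ fixes F i (all F i agree mod p), and then ⌊w i / A⌋ fixes the point on the
  -- line A u + b w = F i; so i ↦ (⌊F i / p⌋ , ⌊w i / A⌋) is injective.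
  linear-residue-count : ∀ {N h H A b p} .{{_ : NonZero A}} .{{_ : NonZero p}} → Coprime A b →
    (u w : Fin N → ℕ) → (∀ i → u i ≤ h) → (∀ i → w i ≤ H) →
    (∀ i j → u i ≡ u j → w i ≡ w j → i ≡ j) →
    (∀ i j → A * u j + b * w j ≤ A * u i + b * w i →
       p ∣ (A * u i + b * w i) ∸ (A * u j + b * w j)) →
    N ≤ suc ((A * h + b * H) / p) * suc (H / A)
  linear-residue-count {N} {h} {H} {A} {b} {p} A⊥b u w u≤h w≤H distinct p∣ΔF =
    injective⇒≤ {f = box} box-injective
    where
    F : Fin N → ℕ
    F i = A * u i + b * w i
    F≤ : ∀ i → F i ≤ A * h + b * H
    F≤ i = +-mono-≤ (*-monoʳ-≤ A (u≤h i)) (*-monoʳ-≤ b (w≤H i))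
    box : Fin N → Fin (suc ((A * h + b * H) / p) * suc (H / A))
    box i = combine (fromℕ< (s≤s (/-monoˡ-≤ p (F≤ i)))) (fromℕ< (s≤s (/-monoˡ-≤ A (w≤H i))))
    F-injective : ∀ i j → F i / p ≡ F j / p → F i ≡ F j
    F-injective i j eq with ≤-total (F j) (F i)
    ... | inj₁ Fj≤Fi = ∣∸∧/-≡⇒≡ p Fj≤Fi (p∣ΔF i j Fj≤Fi) eq
    ... | inj₂ Fi≤Fj = sym (∣∸∧/-≡⇒≡ p Fi≤Fj (p∣ΔF j i Fi≤Fj) (sym eq))
    same-point : ∀ i j → F i ≡ F j → w i / A ≡ w j / A → i ≡ j
    same-point i j eq eq′ with ≤-total (w j) (w i)
    ... | inj₁ wj≤wi with coprime-line-unique A⊥b wj≤wi (/-≡⇒∸< A wj≤wi eq′) eq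
    ...   | u≡ , w≡ = distinct i j u≡ w≡
    same-point i j eq eq′ | inj₂ wi≤wj
      with coprime-line-unique A⊥b wi≤wj (/-≡⇒∸< A wi≤wj (sym eq′)) (sym eq)
    ...   | u≡ , w≡ = sym (distinct j i u≡ w≡)
    box-injective : ∀ {i j} → box i ≡ box j → i ≡ j
    box-injective {i} {j} eq with combine-injective _ _ _ _ eq
    ... | eq₁ , eq₂ = same-point i j (F-injective i j (fromℕ<-injective _ _ _ _ eq₁))
                                     (fromℕ<-injective _ _ _ _ eq₂)

module Estimates where
  open import Data.Nat
  open import Data.Nat.Properties
  open import Data.Nat.Tactic.RingSolver using (solve)
  open import Data.List using ([]; _∷_)
  open import Relation.Binary.PropositionalEquality

  15HD<gp∧g≤D⇒H≤p : ∀ {p g D H} → 15 * H * D < g * p → g ≤ D → H ≤ p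
  15HD<gp∧g≤D⇒H≤p {p} {g} {D} {H} 15HD<gp g≤D =
    ≤-trans (m≤n*m H 15) (<⇒≤ (*-cancelʳ-< D (15 * H) p (begin-strict
      15 * H * D  <⟨ 15HD<gp ⟩
      g * p       ≤⟨ *-monoˡ-≤ p g≤D ⟩
      D * p       ≡⟨ *-comm D p ⟩
      p * D       ∎)))
    where open ≤-Reasoning

  -- K and M stand for ⌊(A h + b H) / p⌋ and ⌊H / A⌋, and γ = g / D.
  box-product-bound : ∀ {p g D h H A b K M} → 0 < p → 0 < A →
    15 * H * D < g * p → b * g < D → H * D < A * (g * h) → A ≤ H →
    K * p ≤ A * h + b * H → M * A ≤ H → 15 * D * K * suc M < 4 * (g * h)
  box-product-bound {p} {g} {D} {h} {H} {A} {b} {K} {M}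
    0<p 0<A 15HD<gp bg<D HD<Agh A≤H Kp≤ MA≤H = *-cancelʳ-< (p * A) _ _ (begin-strict
      15 * D * K * (1 + M) * (p * A)
        ≡⟨ solve (D ∷ K ∷ M ∷ p ∷ A ∷ []) ⟩
      15 * D * ((K * p) * (A + M * A))
        ≤⟨ *-monoʳ-≤ (15 * D) (*-mono-≤ Kp≤ (+-mono-≤ A≤H MA≤H)) ⟩
      15 * D * ((A * h + b * H) * (H + H))
        ≡⟨ solve (D ∷ A ∷ h ∷ b ∷ H ∷ []) ⟩
      2 * (15 * H * D * (A * h) + 15 * b * H * (H * D))
        ≤⟨ *-monoʳ-≤ 2 (+-mono-≤ (*-monoˡ-≤ (A * h) (<⇒≤ 15HD<gp)) (*-monoˡ-≤ (H * D) (<⇒≤ 15bH<p))) ⟩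
      2 * (g * p * (A * h) + p * (H * D))
        <⟨ *-monoʳ-< 2 (+-monoʳ-< (g * p * (A * h)) (*-monoʳ-< p {{>-nonZero 0<p}} HD<Agh)) ⟩
      2 * (g * p * (A * h) + p * (A * (g * h)))
        ≡⟨ solve (g ∷ p ∷ A ∷ h ∷ []) ⟩
      4 * (g * h) * (p * A) ∎)
    where
    open ≤-Reasoning
    15bH<p : 15 * b * H < p
    15bH<p = *-cancelʳ-< D (15 * b * H) p (begin-strict
      15 * b * H * D  ≡⟨ solve (b ∷ H ∷ D ∷ []) ⟩
      15 * H * D * b  ≤⟨ *-monoˡ-≤ b (<⇒≤ 15HD<gp) ⟩
      g * p * b       ≡⟨ solve (g ∷ p ∷ b ∷ []) ⟩
      b * g * p       <⟨ *-monoˡ-< p {{>-nonZero 0<p}} bg<D ⟩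
      D * p           ≡⟨ *-comm D p ⟩
      p * D           ∎)

  count-exceeds-box-product : ∀ {p g D h H N A b K M} → 0 < p →
    15 * H * D < g * p → g * h + D ≤ N * D → b * g < D → H * D < A * (g * h) → A ≤ H →
    K * p ≤ A * h + b * H → M * A ≤ H → suc K * suc M < N
  count-exceeds-box-product {p} {g} {D} {h} {H} {N} {A} {b} {zero} {M}
    0<p 15HD<gp gh+D≤ND bg<D HD<Agh A≤H Kp≤ MA≤H = *-cancelʳ-< D _ _ (begin-strict
      1 * (1 + M) * D  ≡⟨ solve (M ∷ D ∷ []) ⟩
      D + M * D        <⟨ +-monoʳ-< D MD<gh ⟩
      D + g * h        ≡⟨ +-comm D (g * h) ⟩
      g * h + D        ≤⟨ gh+D≤ND ⟩
      N * D            ∎)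
    where
    open ≤-Reasoning
    MD<gh : M * D < g * h
    MD<gh = *-cancelʳ-< A (M * D) (g * h) (begin-strict
      M * D * A    ≡⟨ solve (M ∷ D ∷ A ∷ []) ⟩
      M * A * D    ≤⟨ *-monoˡ-≤ D MA≤H ⟩
      H * D        <⟨ HD<Agh ⟩
      A * (g * h)  ≡⟨ *-comm A (g * h) ⟩
      g * h * A    ∎)
  count-exceeds-box-product {p} {g} {D} {h} {H} {N} {A} {b} {suc k} {M}
    0<p 15HD<gp gh+D≤ND bg<D HD<Agh A≤H Kp≤ MA≤H = *-cancelʳ-< (15 * D) _ _ (begin-strict
      (2 + k) * (1 + M) * (15 * D)
        ≤⟨ *-monoˡ-≤ (15 * D) (*-monoˡ-≤ (1 + M) (+-monoʳ-≤ 2 (m≤n*m k 2))) ⟩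
      (2 + 2 * k) * (1 + M) * (15 * D)
        ≡⟨ solve (k ∷ M ∷ D ∷ []) ⟩
      2 * (15 * D * (1 + k) * (1 + M))
        <⟨ *-monoʳ-< 2 (box-product-bound {p} {g} {D} {h} {H} {A} {b} {suc k} {M}
                          0<p 0<A 15HD<gp bg<D HD<Agh A≤H Kp≤ MA≤H) ⟩
      2 * (4 * (g * h))
        ≡⟨ solve (g ∷ h ∷ []) ⟩
      8 * (g * h)
        ≤⟨ *-monoˡ-≤ (g * h) (m≤m+n 8 7) ⟩
      15 * (g * h)
        ≤⟨ *-monoʳ-≤ 15 (m≤m+n (g * h) D) ⟩
      15 * (g * h + D)
        ≤⟨ *-monoʳ-≤ 15 gh+D≤ND ⟩
      15 * (N * D)
        ≡⟨ solve (N ∷ D ∷ []) ⟩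
      N * (15 * D) ∎)
    where
    open ≤-Reasoning
    0<A : 0 < A
    0<A = n≢0⇒n>0 λ { refl → n≮0 HD<Agh }

module IntegerDifferences where
  open import Data.Nat as ℕ using (ℕ; _≤_; _<_; _∸_; _*_; _+_)
  import Data.Nat.Properties as ℕ
  import Data.Nat.Divisibility as ℕ
  open import Data.Integer as ℤ using (ℤ; +_; _-_; ∣_∣; 0ℤ)
  open import Data.Integer.Properties
  open import Data.Integer.Divisibility.Signed using (_∣_; ∣⇒∣ᵤ)
  open import Data.Sum using (inj₁; inj₂)
  open import Relation.Binary.PropositionalEquality
  open Counting using (∣∧<⇒≡0)

  +m-+n≡+[m∸n] : ∀ {m n} → n ≤ m → + m - + n ≡ + (m ∸ n)
  +m-+n≡+[m∸n] {m} {n} n≤m = trans (m-n≡m⊖n m n) (⊖-≥ n≤m)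

  ∣+m-+n∣< : ∀ {m n H} → m < H → n < H → ∣ + m - + n ∣ < H
  ∣+m-+n∣< {m} {n} {H} m<H n<H rewrite m-n≡m⊖n m n with ℕ.≤-total n m
  ... | inj₁ n≤m = subst (_< H) (sym (trans (∣m⊖n∣≡∣n⊖m∣ m n) (∣⊖∣-≤ n≤m)))
                     (ℕ.≤-<-trans (ℕ.m∸n≤m m n) m<H)
  ... | inj₂ m≤n = subst (_< H) (sym (∣⊖∣-≤ m≤n)) (ℕ.≤-<-trans (ℕ.m∸n≤m n m) n<H)

  ∣∧∣∣<⇒≡0 : ∀ {d z} → + d ∣ z → ∣ z ∣ < d → z ≡ 0ℤ
  ∣∧∣∣<⇒≡0 d∣z ∣z∣<d = ∣i∣≡0⇒i≡0 (∣∧<⇒≡0 (∣⇒∣ᵤ d∣z) ∣z∣<d)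

  pos-*+* : ∀ A b u w → + (A * u + b * w) ≡ + A ℤ.* + u ℤ.+ + b ℤ.* + w
  pos-*+* A b u w = cong₂ ℤ._+_ (pos-* A u) (pos-* b w)

  ∣+m-+n⇒∣m∸n : ∀ {d m n} → n ≤ m → + d ∣ + m - + n → d ℕ.∣ m ∸ n
  ∣+m-+n⇒∣m∸n n≤m d∣m-n = ∣⇒∣ᵤ (subst (+ _ ∣_) (+m-+n≡+[m∸n] n≤m) d∣m-n)

module Fractions where
  open import Data.Nat as ℕ using (ℕ; suc; _+_; _*_)
  open import Data.Integer as ℤ using (+_)
  import Data.Integer.Properties as ℤ
  import Data.Nat.Properties as ℕ
  open import Data.Rational as ℚ using (ℚ; toℚᵘ; 1ℚ)
  import Data.Rational.Properties as ℚ
  open import Data.Rational.Unnormalised as ℚᵘ using (mkℚᵘ; *≤*; *<*)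
  import Data.Rational.Unnormalised.Properties as ℚᵘ
  open import Relation.Binary.PropositionalEquality
  open import Defs using (ℕ→ℚ)

  -- q ≐ n /1+ d : q is the fraction n / (1 + d), not necessarily in lowest terms.
  infix 4 _≐_/1+_
  _≐_/1+_ : ℚ → ℕ → ℕ → Set
  q ≐ n /1+ d = toℚᵘ q ℚᵘ.≃ mkℚᵘ (+ n) d

  ℕ→ℚ-≐ : ∀ n → ℕ→ℚ n ≐ n /1+ 0
  ℕ→ℚ-≐ n = ℚ.toℚᵘ-fromℚᵘ (mkℚᵘ (+ n) 0)

  *-≐ : ∀ {q r a d b e} → q ≐ a /1+ d → r ≐ b /1+ e → q ℚ.* r ≐ a * b /1+ (e + d * suc e)
  *-≐ {q} {r} {a} {d} {b} {e} q≐ r≐ = ℚᵘ.≃-trans (ℚ.toℚᵘ-homo-* q r) (ℚᵘ.≃-trans (ℚᵘ.*-cong q≐ r≐)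
    (ℚᵘ.≃-reflexive (cong (λ n → mkℚᵘ n _) (sym (ℤ.pos-* a b)))))

  *ℕ→ℚ-≐ : ∀ {q a d} n → q ≐ a /1+ d → q ℚ.* ℕ→ℚ n ≐ a * n /1+ d
  *ℕ→ℚ-≐ {d = d} n q≐ = ℚᵘ.≃-trans (*-≐ q≐ (ℕ→ℚ-≐ n))
    (ℚᵘ.≃-reflexive (cong (mkℚᵘ _) (ℕ.*-identityʳ d)))

  ℕ→ℚ*-≐ : ∀ {q a d} n → q ≐ a /1+ d → ℕ→ℚ n ℚ.* q ≐ n * a /1+ d
  ℕ→ℚ*-≐ {d = d} n q≐ = ℚᵘ.≃-trans (*-≐ (ℕ→ℚ-≐ n) q≐)
    (ℚᵘ.≃-reflexive (cong (mkℚᵘ _) (ℕ.+-identityʳ d)))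

  +1ℚ-≐ : ∀ {q a d} → q ≐ a /1+ d → q ℚ.+ 1ℚ ≐ a + suc d /1+ d
  +1ℚ-≐ {q} {a} {d} q≐ = ℚᵘ.≃-trans (ℚ.toℚᵘ-homo-+ q 1ℚ) (ℚᵘ.≃-trans (ℚᵘ.+-cong q≐ ℚᵘ.≃-refl)
    (ℚᵘ.≃-reflexive (cong₂ mkℚᵘ (cong₂ ℤ._+_ (ℤ.*-identityʳ (+ a)) (ℤ.*-identityˡ (+ suc d)))
                                (ℕ.*-identityʳ d))))

  module _ {q r : ℚ} {a d b e : ℕ} (q≐ : q ≐ a /1+ d) (r≐ : r ≐ b /1+ e) where

    ≐-cancel-≤ : q ℚ.≤ r → a * suc e ℕ.≤ b * suc d
    ≐-cancel-≤ q≤r with ℚᵘ.≤-respˡ-≃ q≐ (ℚᵘ.≤-respʳ-≃ r≐ (ℚ.toℚᵘ-mono-≤ q≤r))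
    ... | *≤* ae≤bd = ℤ.drop‿+≤+ (subst₂ ℤ._≤_ (sym (ℤ.pos-* a (suc e))) (sym (ℤ.pos-* b (suc d))) ae≤bd)

    ≐-cancel-< : q ℚ.< r → a * suc e ℕ.< b * suc d
    ≐-cancel-< q<r with ℚᵘ.<-respˡ-≃ q≐ (ℚᵘ.<-respʳ-≃ r≐ (ℚ.toℚᵘ-mono-< q<r))
    ... | *<* ae<bd = ℤ.drop‿+<+ (subst₂ ℤ._<_ (sym (ℤ.pos-* a (suc e))) (sym (ℤ.pos-* b (suc d))) ae<bd)

    ≐-mono-≤ : a * suc e ℕ.≤ b * suc d → q ℚ.≤ r
    ≐-mono-≤ ae≤bd = ℚ.toℚᵘ-cancel-≤ (ℚᵘ.≤-respˡ-≃ (ℚᵘ.≃-sym q≐) (ℚᵘ.≤-respʳ-≃ (ℚᵘ.≃-sym r≐)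
      (*≤* (subst₂ ℤ._≤_ (ℤ.pos-* a (suc e)) (ℤ.pos-* b (suc d)) (ℤ.+≤+ ae≤bd)))))

module SolutionSets where
  open import Data.Nat as ℕ using (ℕ; suc; _≤_; _<_; _∸_; _*_; _+_; NonZero)
  import Data.Nat.Properties as ℕ
  open import Data.Nat.DivMod using (_/_; /-monoˡ-≤; m/n*n≤m)
  open import Data.Nat.Coprimality using (Coprime)
  open import Data.Integer as ℤ using (ℤ; +_; -_; _-_; ∣_∣; -[1+_])
  open import Data.Integer.Properties using (+-injective; i-j≡0⇒i≡j)
  open import Data.Integer.Divisibility.Signed using (_∣_; ∣m∣n⇒∣m-n; ∣n⇒∣m*n; ∣m⇒∣-m)
  open import Data.Integer.Tactic.RingSolver using (solve-∀)
  open import Data.Fin as Fin using (Fin; fromℕ<)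
  import Data.Fin.Properties as Fin
  open import Data.Product using (_×_; _,_; ∃₂)
  open import Data.Empty using (⊥-elim)
  open import Relation.Binary.Definitions using (tri<; tri≈; tri>)
  open import Relation.Binary.PropositionalEquality
  open import Defs using (_≡_[mod_])
  open Counting using (linear-residue-count)
  open IntegerDifferences

  -- A solution (x₀ + 1 + u , y₀ + 1 + v) ∈ I × J is recorded by its offsets (u , v):
  -- the argument only uses differences of solutions.
  record Solutions (p : ℕ) (s : ℤ) (h H N : ℕ) : Set where
    field
      u v       : Fin N → ℕ
      u<h       : ∀ i → u i < h
      v<H       : ∀ i → v i < H
      distinct  : ∀ i j → u i ≡ u j → v i ≡ v j → i ≡ j
      congruent : ∀ i j → (+ v i - + v j) ≡ s ℤ.* (+ u i - + u j) [mod p ]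

  module _ {p s h H N} (S : Solutions p s h H N) where
    open Solutions S

    residue-class-count : ∀ {A b} .{{_ : NonZero A}} .{{_ : NonZero p}} → Coprime A b →
      (w : Fin N → ℕ) → (∀ i → w i ≤ H) → (∀ i j → u i ≡ u j → w i ≡ w j → i ≡ j) →
      (∀ i j → + p ∣ (+ (A * u i + b * w i) - + (A * u j + b * w j))) →
      N ≤ suc ((A * h + b * H) / p) * suc (H / A)
    residue-class-count A⊥b w w≤H w-distinct p∣ΔF = linear-residue-count A⊥b u w (λ i → ℕ.<⇒≤ (u<h i)) w≤H w-distinct
      (λ i j Fj≤Fi → ∣+m-+n⇒∣m∸n Fj≤Fi (p∣ΔF i j))

    u-injective : H ≤ p → ∀ i j → u i ≡ u j → i ≡ j
    u-injective H≤p i j ui≡uj = distinct i j ui≡uj (+-injective (i-j≡0⇒i≡j _ _ Δv≡0))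
      where
      vanish : ∀ Y s X → Y - s ℤ.* (X - X) ≡ Y
      vanish = solve-∀
      p∣Δv : + p ∣ (+ v i - + v j)
      p∣Δv = subst (+ p ∣_) (vanish _ s (+ u j))
               (subst (λ x → + p ∣ ((+ v i - + v j) - s ℤ.* (+ x - + u j))) ui≡uj (congruent i j))
      Δv≡0 : + v i - + v j ≡ + 0
      Δv≡0 = ∣∧∣∣<⇒≡0 p∣Δv (ℕ.<-≤-trans (∣+m-+n∣< (v<H i) (v<H j)) H≤p)

    cross-congruent : ∀ a b → a ≡ s ℤ.* (+ b) [mod p ] →
      ∀ i j → (a ℤ.* (+ u i - + u j)) ≡ (+ b ℤ.* (+ v i - + v j)) [mod p ]
    cross-congruent a b a≡sb i j =
      subst (+ p ∣_) (sym (cross a (+ b) s (+ u i - + u j) (+ v i - + v j)))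
        (∣m∣n⇒∣m-n (∣n⇒∣m*n (+ u i - + u j) a≡sb) (∣n⇒∣m*n (+ b) (congruent i j)))
      where
      cross : ∀ a b s X Y → a ℤ.* X - b ℤ.* Y ≡ X ℤ.* (a - s ℤ.* b) - b ℤ.* (Y - s ℤ.* X)
      cross = solve-∀

    close-pair : ∀ {g D} → H ≤ p → 0 < g → 0 < D → g * h + D ≤ N * D →
      ∃₂ λ i j → u j < u i × (u i ∸ u j) * g < D
    close-pair {g} {D} H≤p 0<g 0<D gh+D≤ND = from-collision (Fin.pigeonhole boxes<N box)
      where
      instance
        D-nonZero : NonZero D
        D-nonZero = ℕ.>-nonZero 0<D
      box : Fin N → Fin (suc (ℕ.pred h * g / D))
      box i = fromℕ< (ℕ.s≤s (/-monoˡ-≤ D (ℕ.*-monoˡ-≤ g (ℕ.<⇒≤pred (u<h i)))))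
      same-box : ∀ {i j} → box i ≡ box j → u i * g / D ≡ u j * g / D
      same-box = Fin.fromℕ<-injective _ _ _ _
      close : ∀ i j → u j ≤ u i → u i * g / D ≡ u j * g / D → (u i ∸ u j) * g < D
      close i j uj≤ui eq = subst (_< D) (sym (ℕ.*-distribʳ-∸ g (u i) (u j)))
                                 (Counting./-≡⇒∸< D (ℕ.*-monoˡ-≤ g uj≤ui) eq)
      0<N : 0 < N
      0<N = ℕ.n≢0⇒n>0 λ N≡0 → ℕ.<⇒≱ 0<D (ℕ.≤-trans (ℕ.m≤n+m D (g * h))
              (subst (λ n → g * h + D ≤ n * D) N≡0 gh+D≤ND))
      instance
        h-nonZero : NonZero h
        h-nonZero = ℕ.>-nonZero (ℕ.≤-<-trans ℕ.z≤n (u<h (fromℕ< 0<N)))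
      boxes<N : suc (ℕ.pred h * g / D) < N
      boxes<N = ℕ.*-cancelʳ-< D _ _ (begin-strict
        suc (ℕ.pred h * g / D) * D   ≤⟨ ℕ.+-monoʳ-≤ D (m/n*n≤m (ℕ.pred h * g) D) ⟩
        D + ℕ.pred h * g             <⟨ ℕ.+-monoʳ-< D (ℕ.*-monoˡ-< g {{ℕ.>-nonZero 0<g}} pred-h<h) ⟩
        D + h * g                    ≡⟨ cong (λ n → D + n) (ℕ.*-comm h g) ⟩
        D + g * h                    ≡⟨ ℕ.+-comm D (g * h) ⟩
        g * h + D                    ≤⟨ gh+D≤ND ⟩
        N * D                        ∎)
        where
        open ℕ.≤-Reasoning
        pred-h<h : ℕ.pred h < h
        pred-h<h = subst (ℕ.pred h <_) (ℕ.suc-pred h) (ℕ.n<1+n (ℕ.pred h))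
      from-collision : (∃₂ λ i j → i Fin.< j × box i ≡ box j) →
        ∃₂ λ i j → u j < u i × (u i ∸ u j) * g < D
      from-collision (i , j , i<j , box≡) with ℕ.<-cmp (u i) (u j)
      ... | tri< ui<uj _ _ = j , i , ui<uj , close j i (ℕ.<⇒≤ ui<uj) (sym (same-box box≡))
      ... | tri≈ _ ui≡uj _ = ⊥-elim (Fin.<⇒≢ i<j (u-injective H≤p i j ui≡uj))
      ... | tri> _ _ uj<ui = i , j , uj<ui , close i j (ℕ.<⇒≤ uj<ui) (same-box box≡)

    -- a u − b v is constant mod p; for a ≥ 0 the reflection v ↦ H − v makes both coefficients non-negative.
    count-bound : ∀ (a : ℤ) b .{{_ : NonZero ∣ a ∣}} .{{_ : NonZero p}} → Coprime ∣ a ∣ b →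
      a ≡ s ℤ.* (+ b) [mod p ] → N ≤ suc ((∣ a ∣ * h + b * H) / p) * suc (H / ∣ a ∣)
    count-bound (+ A) b A⊥b a≡sb =
      residue-class-count A⊥b (λ i → H ∸ v i) (λ i → ℕ.m∸n≤m H (v i)) w-distinct λ i j →
        subst (+ p ∣_) (reflected i j) (cross-congruent (+ A) b a≡sb i j)
      where
      v≤H : ∀ i → v i ≤ H
      v≤H i = ℕ.<⇒≤ (v<H i)
      w-distinct : ∀ i j → u i ≡ u j → H ∸ v i ≡ H ∸ v j → i ≡ j
      w-distinct i j ui≡uj wi≡wj = distinct i j ui≡uj (ℕ.∸-cancelˡ-≡ (v≤H i) (v≤H j) wi≡wj)
      identity : ∀ A b U V U′ V′ H →
        A ℤ.* (U - U′) - b ℤ.* (V - V′) ≡ (A ℤ.* U ℤ.+ b ℤ.* (H - V)) - (A ℤ.* U′ ℤ.+ b ℤ.* (H - V′))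
      identity = solve-∀
      reflected : ∀ i j → + A ℤ.* (+ u i - + u j) - + b ℤ.* (+ v i - + v j)
                          ≡ + (A * u i + b * (H ∸ v i)) - + (A * u j + b * (H ∸ v j))
      reflected i j = begin
        + A ℤ.* (+ u i - + u j) - + b ℤ.* (+ v i - + v j)
          ≡⟨ identity (+ A) (+ b) (+ u i) (+ v i) (+ u j) (+ v j) (+ H) ⟩
        (+ A ℤ.* + u i ℤ.+ + b ℤ.* (+ H - + v i)) - (+ A ℤ.* + u j ℤ.+ + b ℤ.* (+ H - + v j))
          ≡⟨ cong₂ _-_ (embed i) (embed j) ⟩
        + (A * u i + b * (H ∸ v i)) - + (A * u j + b * (H ∸ v j)) ∎
        where
        open ≡-Reasoning
        embed : ∀ i → + A ℤ.* + u i ℤ.+ + b ℤ.* (+ H - + v i) ≡ + (A * u i + b * (H ∸ v i))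
        embed i rewrite +m-+n≡+[m∸n] (v≤H i) = sym (pos-*+* A b (u i) (H ∸ v i))
    count-bound -[1+ n ] b A⊥b a≡sb =
      residue-class-count A⊥b v (λ i → ℕ.<⇒≤ (v<H i)) distinct λ i j →
        subst (+ p ∣_) (direct i j) (∣m⇒∣-m (cross-congruent -[1+ n ] b a≡sb i j))
      where
      identity : ∀ A b U V U′ V′ →
        - ((- A) ℤ.* (U - U′) - b ℤ.* (V - V′)) ≡ (A ℤ.* U ℤ.+ b ℤ.* V) - (A ℤ.* U′ ℤ.+ b ℤ.* V′)
      identity = solve-∀
      direct : ∀ i j → - (-[1+ n ] ℤ.* (+ u i - + u j) - + b ℤ.* (+ v i - + v j))
                       ≡ + (suc n * u i + b * v i) - + (suc n * u j + b * v j)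
      direct i j = trans (identity (+ suc n) (+ b) (+ u i) (+ v i) (+ u j) (+ v j))
        (cong₂ _-_ (sym (pos-*+* (suc n) b (u i) (v i))) (sym (pos-*+* (suc n) b (u j) (v j))))

module Enumeration where
  open import Data.Nat as ℕ using (ℕ; suc; _<_)
  import Data.Nat.Properties as ℕ
  open import Data.Integer as ℤ using (ℤ; +_; _-_)
  open import Data.Integer.Properties using (+-0-abelianGroup; +-injective)
  open import Algebra.Properties.AbelianGroup +-0-abelianGroup using (∙-cancelˡ)
  open import Data.Integer.Divisibility.Signed using (_∣_; ∣m∣n⇒∣m-n)
  open import Data.Integer.Tactic.RingSolver using (solve-∀)
  open import Data.List using (List; _∷_; length; filter; lookup; cartesianProduct)
  open import Data.List.Relation.Unary.All as All using ()
  open import Data.List.Relation.Unary.AllPairs using (_∷_)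
  open import Data.List.Relation.Unary.Unique.Propositional using (Unique)
  import Data.List.Relation.Unary.Unique.Propositional.Properties as Unique
  open import Data.List.Membership.Propositional using (_∈_)
  open import Data.List.Membership.Propositional.Properties
    using (∈-lookup; ∈-filter⁻; ∈-cartesianProduct⁻; ∈-map⁻; ∈-upTo⁻)
  open import Data.Fin using (Fin; zero; suc)
  open import Data.Product using (_×_; _,_; proj₁; proj₂; ∃)
  open import Function using (_∘_)
  open import Data.Empty using (⊥-elim)
  open import Relation.Binary.PropositionalEquality
  open import Relation.Unary using (Pred; Decidable)
  open import Level using (0ℓ)
  open import Defs using (_≡_[mod_]; interval)
  open SolutionSets using (Solutions)

  lookup-injective : ∀ {A : Set} {xs : List A} → Unique xs →
    ∀ {i j} → lookup xs i ≡ lookup xs j → i ≡ j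
  lookup-injective (_ ∷ _)        {zero}  {zero}  _  = refl
  lookup-injective (x∉xs ∷ _)     {zero}  {suc j} eq = ⊥-elim (All.lookup x∉xs (∈-lookup j) eq)
  lookup-injective (x∉xs ∷ _)     {suc i} {zero}  eq = ⊥-elim (All.lookup x∉xs (∈-lookup i) (sym eq))
  lookup-injective (_ ∷ unique)   {suc i} {suc j} eq = cong suc (lookup-injective unique eq)

  interval-unique : ∀ x₀ h → Unique (interval x₀ h)
  interval-unique x₀ h = Unique.map⁺ (λ eq → ℕ.suc-injective (+-injective (∙-cancelˡ x₀ _ _ eq)))
                                     (Unique.upTo⁺ h)

  ∈-interval⁻ : ∀ {x x₀ h} → x ∈ interval x₀ h → ∃ λ k → k < h × x ≡ x₀ ℤ.+ + suc k
  ∈-interval⁻ x∈ with ∈-map⁻ _ x∈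
  ... | k , k∈ , x≡ = k , ∈-upTo⁻ k∈ , x≡

  record GridOffsets (x₀ y₀ : ℤ) (h H : ℕ) (xy : ℤ × ℤ) : Set where
    field
      k l : ℕ
      k<h : k < h
      l<H : l < H
      xy≡ : xy ≡ (x₀ ℤ.+ + suc k , y₀ ℤ.+ + suc l)

  ∈-grid⁻ : ∀ {x₀ y₀ h H x y} → (x , y) ∈ cartesianProduct (interval x₀ h) (interval y₀ H) →
    GridOffsets x₀ y₀ h H (x , y)
  ∈-grid⁻ {x₀} {y₀} {h} {H} xy∈ with ∈-cartesianProduct⁻ (interval x₀ h) (interval y₀ H) xy∈
  ... | x∈ , y∈ with ∈-interval⁻ {x₀ = x₀} x∈ | ∈-interval⁻ {x₀ = y₀} y∈
  ...   | k , k<h , x≡ | l , l<H , y≡ = record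
    { k = k ; l = l ; k<h = k<h ; l<H = l<H ; xy≡ = cong₂ _,_ x≡ y≡ }

  enumerate : ∀ {p s} {P : Pred (ℤ × ℤ) 0ℓ} (P? : Decidable P) →
    (∀ {x y} → P (x , y) → y ≡ s ℤ.* x [mod p ]) → ∀ x₀ y₀ h H →
    Solutions p s h H (length (filter P? (cartesianProduct (interval x₀ h) (interval y₀ H))))
  enumerate {p} {s} {P} P? solves x₀ y₀ h H = record
    { u = u ; v = v ; u<h = k<h ∘ offsets ; v<H = l<H ∘ offsets
    ; distinct = distinct ; congruent = congruent }
    where
    open GridOffsets
    grid = cartesianProduct (interval x₀ h) (interval y₀ H)
    L = filter P? grid
    offsets : ∀ i → GridOffsets x₀ y₀ h H (lookup L i)
    offsets i = ∈-grid⁻ (proj₁ (∈-filter⁻ P? {xs = grid} (∈-lookup {xs = L} i)))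
    u v : Fin (length L) → ℕ
    u i = k (offsets i)
    v i = l (offsets i)
    distinct : ∀ i j → u i ≡ u j → v i ≡ v j → i ≡ j
    distinct i j ui≡uj vi≡vj = lookup-injective unique-L (begin
      lookup L i                                  ≡⟨ xy≡ (offsets i) ⟩
      (x₀ ℤ.+ + suc (u i) , y₀ ℤ.+ + suc (v i))  ≡⟨ cong₂ (λ m n → (x₀ ℤ.+ + suc m , y₀ ℤ.+ + suc n)) ui≡uj vi≡vj ⟩
      (x₀ ℤ.+ + suc (u j) , y₀ ℤ.+ + suc (v j))  ≡⟨ xy≡ (offsets j) ⟨
      lookup L j                                  ∎)
      where
      open ≡-Reasoning
      unique-L : Unique L
      unique-L = Unique.filter⁺ P? (Unique.cartesianProduct⁺ (interval-unique x₀ h) (interval-unique y₀ H))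
    solution : ∀ i → (y₀ ℤ.+ + suc (v i)) ≡ s ℤ.* (x₀ ℤ.+ + suc (u i)) [mod p ]
    solution i = solves (subst P (xy≡ (offsets i)) (proj₂ (∈-filter⁻ P? {xs = grid} (∈-lookup {xs = L} i))))
    difference : ∀ x₀ y₀ s U V U′ V′ →
      ((y₀ ℤ.+ (ℤ.1ℤ ℤ.+ V)) - s ℤ.* (x₀ ℤ.+ (ℤ.1ℤ ℤ.+ U))) - ((y₀ ℤ.+ (ℤ.1ℤ ℤ.+ V′)) - s ℤ.* (x₀ ℤ.+ (ℤ.1ℤ ℤ.+ U′)))
        ≡ (V - V′) - s ℤ.* (U - U′)
    difference = solve-∀
    congruent : ∀ i j → (+ v i - + v j) ≡ s ℤ.* (+ u i - + u j) [mod p ]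
    congruent i j = subst (+ p ∣_) (difference x₀ y₀ s (+ u i) (+ v i) (+ u j) (+ v j))
                          (∣m∣n⇒∣m-n (solution i) (solution j))

module SmallFractions where
  open import Data.Nat as ℕ using (ℕ; _≤_; _<_; _∸_; _*_; _+_; NonZero)
  import Data.Nat.Properties as ℕ
  import Data.Nat.Divisibility as ℕ
  open import Data.Nat.DivMod using (_/_; m/n*n≡m; m/n*n≤m)
  open import Data.Nat.GCD using (gcd; gcd[m,n]∣m; gcd[m,n]∣n; gcd[m,n]≢0)
  open import Data.Nat.Coprimality as Coprime using (Coprime; coprime-/gcd)
  open import Data.Nat.Primality using (Prime; euclidsLemma; prime⇒nonZero)
  open import Data.Integer as ℤ using (ℤ; +_; _-_; ∣_∣; sign; _◃_)
  open import Data.Integer.Properties using (pos-*; abs-◃; +◃n≡+n; ◃-inverse; ◃-distrib-*; ∣i*j∣≡∣i∣*∣j∣)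
  open import Data.Integer.Divisibility.Signed using (_∣_; ∣⇒∣ᵤ; ∣ᵤ⇒∣)
  open import Data.Integer.Tactic.RingSolver using (solve-∀)
  import Data.Sign as Sign
  import Data.Sign.Properties as Sign
  open import Data.Product using (_×_; _,_; ∃₂)
  open import Data.Sum using (inj₁; inj₂)
  open import Data.Empty using (⊥-elim)
  open import Relation.Binary.PropositionalEquality
  open import Defs using (_≡_[mod_])
  open Estimates using (count-exceeds-box-product; 15HD<gp∧g≤D⇒H≤p)
  open IntegerDifferences using (+m-+n≡+[m∸n]; ∣+m-+n∣<)
  open SolutionSets

  -- The conclusion of the theorem for γ = g / D, cleared of denominators.
  SmallFraction : (p g D h H : ℕ) → ℤ → Set
  SmallFraction p g D h H s = ∃₂ λ (a : ℤ) (b : ℕ) →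
    ∣ a ∣ * (g * h) ≤ H * D × 0 < b × b * g ≤ D × a ≡ s ℤ.* (+ b) [mod p ]

  record ReducedFraction (p : ℕ) (s Y : ℤ) (B : ℕ) : Set where
    field
      a       : ℤ
      b       : ℕ
      0<b     : 0 < b
      b≤B     : b ≤ B
      ∣a∣≤∣Y∣ : ∣ a ∣ ≤ ∣ Y ∣
      a⊥b     : Coprime ∣ a ∣ b
      a≡sb    : a ≡ s ℤ.* (+ b) [mod p ]

  reduced-fraction : ∀ {p} (s Y : ℤ) (B : ℕ) → Prime p → 0 < B → B < p →
    Y ≡ s ℤ.* (+ B) [mod p ] → ReducedFraction p s Y B
  reduced-fraction {p} s Y B p-prime 0<B B<p Y≡sB = record
    { a = a ; b = b ; 0<b = 0<b ; b≤B = b≤B ; ∣a∣≤∣Y∣ = ∣a∣≤∣Y∣ ; a⊥b = a⊥b ; a≡sb = a≡sb }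
    where
    instance
      B-nonZero : NonZero B
      B-nonZero = ℕ.>-nonZero 0<B
    d = gcd B ∣ Y ∣
    instance
      d-nonZero : NonZero d
      d-nonZero = ℕ.≢-nonZero (gcd[m,n]≢0 B ∣ Y ∣ (inj₁ (ℕ.≢-nonZero⁻¹ B)))
    b = B / d
    A = ∣ Y ∣ / d
    a = sign Y ◃ A
    bd≡B : b * d ≡ B
    bd≡B = m/n*n≡m (gcd[m,n]∣m B ∣ Y ∣)
    Ad≡∣Y∣ : A * d ≡ ∣ Y ∣
    Ad≡∣Y∣ = m/n*n≡m (gcd[m,n]∣n B ∣ Y ∣)
    ∣a∣≡A : ∣ a ∣ ≡ A
    ∣a∣≡A = abs-◃ (sign Y) A
    ad≡Y : a ℤ.* + d ≡ Y
    ad≡Y = begin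
      a ℤ.* + d                         ≡⟨ cong (a ℤ.*_) (+◃n≡+n d) ⟨
      (sign Y ◃ A) ℤ.* (Sign.+ ◃ d)     ≡⟨ ◃-distrib-* (sign Y) Sign.+ A d ⟨
      (sign Y Sign.* Sign.+) ◃ (A * d)  ≡⟨ cong₂ _◃_ (Sign.*-identityʳ (sign Y)) Ad≡∣Y∣ ⟩
      sign Y ◃ ∣ Y ∣                    ≡⟨ ◃-inverse Y ⟩
      Y                                 ∎
      where open ≡-Reasoning
    scale : ∀ a s b d → (a - s ℤ.* b) ℤ.* d ≡ a ℤ.* d - s ℤ.* (b ℤ.* d)
    scale = solve-∀
    [a-sb]d≡Y-sB : (a - s ℤ.* + b) ℤ.* + d ≡ Y - s ℤ.* + B
    [a-sb]d≡Y-sB = trans (scale a s (+ b) (+ d))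
      (cong₂ (λ x y → x - s ℤ.* y) ad≡Y (trans (sym (pos-* b d)) (cong +_ bd≡B)))
    p∣[a-sb]d : p ℕ.∣ ∣ a - s ℤ.* + b ∣ * d
    p∣[a-sb]d = subst (p ℕ.∣_) (∣i*j∣≡∣i∣*∣j∣ (a - s ℤ.* + b) (+ d))
                  (∣⇒∣ᵤ (subst (+ p ∣_) (sym [a-sb]d≡Y-sB) Y≡sB))
    a≡sb : a ≡ s ℤ.* (+ b) [mod p ]
    a≡sb with euclidsLemma _ _ p-prime p∣[a-sb]d
    ... | inj₁ p∣a-sb = ∣ᵤ⇒∣ p∣a-sb
    ... | inj₂ p∣d = ⊥-elim (ℕ.<⇒≱ (ℕ.≤-<-trans (ℕ.∣⇒≤ (gcd[m,n]∣m B ∣ Y ∣)) B<p) (ℕ.∣⇒≤ p∣d))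
    0<b : 0 < b
    0<b = ℕ.n≢0⇒n>0 λ b≡0 → ℕ.<⇒≢ 0<B (trans (cong (_* d) (sym b≡0)) bd≡B)
    b≤B : b ≤ B
    b≤B = subst (b ≤_) bd≡B (ℕ.m≤m*n b d)
    ∣a∣≤∣Y∣ : ∣ a ∣ ≤ ∣ Y ∣
    ∣a∣≤∣Y∣ = subst₂ _≤_ (sym ∣a∣≡A) Ad≡∣Y∣ (ℕ.m≤m*n A d)
    a⊥b : Coprime ∣ a ∣ b
    a⊥b = subst (λ n → Coprime n b) (sym ∣a∣≡A) (Coprime.sym (coprime-/gcd B ∣ Y ∣))

  numerator-bound : ∀ {p s h H N g D} → Solutions p s h H N → 0 < p →
    15 * H * D < g * p → g * h + D ≤ N * D →
    ∀ a b → Coprime ∣ a ∣ b → a ≡ s ℤ.* (+ b) [mod p ] → b * g < D → ∣ a ∣ ≤ H →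
    ∣ a ∣ * (g * h) ≤ H * D
  numerator-bound {p} {s} {h} {H} {N} {g} {D} S 0<p 15HD<gp gh+D≤ND a b a⊥b a≡sb bg<D ∣a∣≤H =
    ℕ.≮⇒≥ λ HD<∣a∣gh →
      let instance
            a-nonZero : NonZero ∣ a ∣
            a-nonZero = ℕ.≢-nonZero λ ∣a∣≡0 → ℕ.n≮0 (subst (λ n → H * D < n * (g * h)) ∣a∣≡0 HD<∣a∣gh)
            p-nonZero : NonZero p
            p-nonZero = ℕ.>-nonZero 0<p
      in ℕ.<⇒≱ (count-exceeds-box-product {p} {g} {D} {h} {H} {N} {∣ a ∣} {b}
                  {(∣ a ∣ * h + b * H) / p} {H / ∣ a ∣} 0<p 15HD<gp gh+D≤ND bg<D HD<∣a∣gh ∣a∣≤H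
                  (m/n*n≤m (∣ a ∣ * h + b * H) p) (m/n*n≤m H ∣ a ∣))
               (count-bound S a b a⊥b a≡sb)

  small-fraction : ∀ {p g D h H N s} → Prime p → 0 < g → 0 < D → g ≤ D → h ≤ H →
    15 * H * D < g * p → g * h + D ≤ N * D → Solutions p s h H N → SmallFraction p g D h H s
  small-fraction {p} {g} {D} {h} {H} {N} {s} p-prime 0<g 0<D g≤D h≤H 15HD<gp gh+D≤ND S =
    from-pair (close-pair S H≤p 0<g 0<D gh+D≤ND)
    where
    open Solutions S
    H≤p : H ≤ p
    H≤p = 15HD<gp∧g≤D⇒H≤p 15HD<gp g≤D
    from-pair : (∃₂ λ i j → u j < u i × (u i ∸ u j) * g < D) → SmallFraction p g D h H s
    from-pair (i , j , uj<ui , Bg<D) =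
      a , b , numerator-bound S (ℕ.>-nonZero⁻¹ p {{prime⇒nonZero p-prime}}) 15HD<gp gh+D≤ND
                a b a⊥b a≡sb bg<D (ℕ.<⇒≤ (ℕ.≤-<-trans ∣a∣≤∣Y∣ (∣+m-+n∣< (v<H i) (v<H j))))
        , 0<b , ℕ.<⇒≤ bg<D , a≡sb
      where
      B<p : u i ∸ u j < p
      B<p = ℕ.≤-<-trans (ℕ.m∸n≤m (u i) (u j)) (ℕ.<-≤-trans (u<h i) (ℕ.≤-trans h≤H H≤p))
      Y≡sB : (+ v i - + v j) ≡ s ℤ.* (+ (u i ∸ u j)) [mod p ]
      Y≡sB = subst (λ x → + p ∣ ((+ v i - + v j) - s ℤ.* x)) (+m-+n≡+[m∸n] (ℕ.<⇒≤ uj<ui)) (congruent i j)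
      open ReducedFraction
        (reduced-fraction s (+ v i - + v j) (u i ∸ u j) p-prime (ℕ.m<n⇒0<n∸m uj<ui) B<p Y≡sB)
      bg<D : b * g < D
      bg<D = ℕ.≤-<-trans (ℕ.*-monoˡ-≤ g b≤B) Bg<D

open import Defs
open import Data.Nat as ℕ using (ℕ)
open import Data.Nat.Primality using (Prime)
open import Data.Integer as ℤ using (ℤ; +_)
open import Data.Rational as ℚ using (ℚ; 0ℚ; 1ℚ)
open import Data.Product using (∃₂; _×_)

import Data.Nat.Properties as ℕ
open import Data.Rational using (mkℚ)
open import Data.Rational.Unnormalised.Properties using (≃-refl)
open import Data.Product using (_,_)
open import Function using (id)
open import Relation.Binary.PropositionalEquality
open Fractions
open Enumeration using (enumerate)
open SmallFractions using (SmallFraction; small-fraction)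

lemma4p1 : (p : ℕ) → Prime p → (γ : ℚ) → 0ℚ ℚ.< γ → γ ℚ.< 1ℚ
    → (x₀ y₀ : ℤ) (h H : ℕ) → h ℕ.≤ H → ℕ→ℚ 15 ℚ.* ℕ→ℚ H ℚ.< γ ℚ.* ℕ→ℚ p
    → (s : ℤ) → γ ℚ.* ℕ→ℚ h ℚ.+ 1ℚ ℚ.≤ ℕ→ℚ (numSolutions p s (interval x₀ h) (interval y₀ H))
    → ∃₂ λ (a : ℤ) (b : ℕ) →
        (ℤ→ℚ (+ ℤ.∣ a ∣) ℚ.* (γ ℚ.* ℕ→ℚ h) ℚ.≤ ℕ→ℚ H)
        × (0 ℕ.< b) × (ℕ→ℚ b ℚ.* γ ℚ.≤ 1ℚ)
        × (a ≡ s ℤ.* (+ b) [mod p ])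
lemma4p1 p p-prime (mkℚ ℤ.-[1+ _ ] _ _) (ℚ.*<* ()) _ _ _ _ _ _ _ _ _
lemma4p1 p p-prime γ@(mkℚ (+ g) d _) 0<γ γ<1 x₀ y₀ h H h≤H 15H<γp s γh+1≤N =
  rational-form (small-fraction p-prime 0<g ℕ.z<s g≤D h≤H 15HD<gp gh+D≤ND
                   (enumerate {s = s} _ id x₀ y₀ h H))
  where
  N = numSolutions p s (interval x₀ h) (interval y₀ H)
  γ≐ : γ ≐ g /1+ d
  γ≐ = ≃-refl
  0<g : 0 ℕ.< g
  0<g = subst (0 ℕ.<_) (ℕ.*-identityʳ g) (≐-cancel-< {0ℚ} ≃-refl γ≐ 0<γ)
  g≤D : g ℕ.≤ ℕ.suc d
  g≤D = ℕ.<⇒≤ (subst₂ ℕ._<_ (ℕ.*-identityʳ g) (ℕ.+-identityʳ (ℕ.suc d)) (≐-cancel-< γ≐ ≃-refl γ<1))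
  15HD<gp : 15 ℕ.* H ℕ.* ℕ.suc d ℕ.< g ℕ.* p
  15HD<gp = subst (15 ℕ.* H ℕ.* ℕ.suc d ℕ.<_) (ℕ.*-identityʳ (g ℕ.* p))
    (≐-cancel-< (*ℕ→ℚ-≐ H (ℕ→ℚ-≐ 15)) (*ℕ→ℚ-≐ p γ≐) 15H<γp)
  gh+D≤ND : g ℕ.* h ℕ.+ ℕ.suc d ℕ.≤ N ℕ.* ℕ.suc d
  gh+D≤ND = subst (ℕ._≤ N ℕ.* ℕ.suc d) (ℕ.*-identityʳ (g ℕ.* h ℕ.+ ℕ.suc d))
    (≐-cancel-≤ (+1ℚ-≐ (*ℕ→ℚ-≐ h γ≐)) (ℕ→ℚ-≐ N) γh+1≤N)
  rational-form : SmallFraction p g (ℕ.suc d) h H s → _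
  rational-form (a , b , ∣a∣gh≤HD , 0<b , bg≤D , a≡sb) =
    a , b
    , ≐-mono-≤ (ℕ→ℚ*-≐ ℤ.∣ a ∣ (*ℕ→ℚ-≐ h γ≐)) (ℕ→ℚ-≐ H)
        (subst (ℕ._≤ H ℕ.* ℕ.suc d) (sym (ℕ.*-identityʳ _)) ∣a∣gh≤HD)
    , 0<b
    , ≐-mono-≤ (ℕ→ℚ*-≐ b γ≐) ≃-refl
        (subst₂ ℕ._≤_ (sym (ℕ.*-identityʳ (b ℕ.* g))) (sym (ℕ.+-identityʳ (ℕ.suc d))) bg≤D)
    , a≡sb
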